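{- For all $\Gamma\cup\{A\}\subseteq \mathsf{Form}_\supset$: if $\Gamma\vdash A$ in the system $\mathbf{S}$, then $\Gamma\models A$.
   Context: Language: formulas $\mathsf{Form}_\supset$ are built from a countable set $\mathsf{Prop}$ of propositional variables using the binary connectives $\land,\lor,\to$ (intuitionistic implication) and $\supset$ (classical implication). Semantics: an $\mathbf{S}$-model is $\langle g,W,\leq,V\rangle$ where $W$ is a set, $g\in W$, $\leq$ is a reflexive and transitive relation on $W$ with $g\leq w$ for all $w\in W$, and $V:W\times\mathsf{Prop}\to\{0,1\}$ satisfies: if $V(w_1,p)=1$ and $w_1\leq w_2$ then $V(w_2,p)=1$. $V$ extends to $I$: $I(w,p)=V(w,p)$; $I(w,A\land B)=1$ iff $I(w,A)=1$ and $I(w,B)=1$; $I(w,A\lor B)=1$ iff $I(w,A)=1$ or $I(w,B)=1$; $I(w,A\supset B)=1$ iff $I(g,A)\neq 1$ or $I(w,B)=1$; $I(w,A\to B)=1$ iff for all $x\in W$ with $w\leq x$, $I(x,A)=1$ implies $I(x,B)=1$. $\Sigma\models A$ iff for every $\mathbf{S}$-model, if $I(g,B)=1$ for all $B\in\Sigma$ then $I(g,A)=1$. Proof system $\mathbf{S}$: axiom schemata (for all formulas $A,B,C$) (Ax1) $A\to(B\to A)$; (Ax2) $(A\to(B\to C))\to((A\to B)\to(A\to C))$; (Ax3) $(A\land B)\to A$; (Ax4) $(A\land B)\to B$; (Ax5) $(C\to A)\to((C\to B)\to(C\to(A\land B)))$; (Ax6) $A\to(A\lor B)$; (Ax7) $B\to(A\lor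 B)$; (Ax8) $(A\to C)\to((B\to C)\to((A\lor B)\to C))$; (AxM1) $(A\to B)\supset(A\supset B)$; (AxM2) $(A\supset(B\supset C))\to((A\supset B)\supset(A\supset C))$; (AxM3) $(A\supset(B\to C))\to(B\to(A\supset C))$; (AxM4) $(A\to(B\supset C))\to(B\supset(A\to C))$; (AxM5) $((A\supset B)\supset C)\to((A\supset C)\to C)$; (AxM6) $(A\supset C)\to((B\supset C)\to((A\lor B)\supset C))$; and the single rule (MP): from $A$ and $A\supset B$ infer $B$. $\Gamma\vdash A$ iff there is a finite sequence ending in $A$ each member of which is in $\Gamma$, an axiom instance, or obtained by (MP) from earlier members. -}

module Defs where

open import Data.Nat using (ℕ)
open import Data.Bool using (Bool; true; false)
open import Data.Product using (_×_)
open import Data.Sum using (_⊎_)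
open import Relation.Binary.PropositionalEquality using (_≡_)
open import Relation.Nullary using (¬_)

Var : Set
Var = ℕ

infixr 6 _∧_
infixr 5 _∨_
infixr 4 _⇒_ _⊃_

-- Form_⊃ ; _⇒_ is intuitionistic implication (→), _⊃_ classical implication
data Form : Set where
  var : Var → Form
  _∧_ : Form → Form → Form
  _∨_ : Form → Form → Form
  _⇒_ : Form → Form → Form
  _⊃_ : Form → Form → Form

FormSet : Set₁
FormSet = Form → Set

data Axiom : Form → Set where
  ax1 : ∀ A B → Axiom (A ⇒ (B ⇒ A))
  ax2 : ∀ A B C → Axiom ((A ⇒ (B ⇒ C)) ⇒ ((A ⇒ B) ⇒ (A ⇒ C)))
  ax3 : ∀ A B → Axiom ((A ∧ B) ⇒ A)
  ax4 : ∀ A B → Axiom ((A ∧ B) ⇒ B)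
  ax5 : ∀ A B C → Axiom ((C ⇒ A) ⇒ ((C ⇒ B) ⇒ (C ⇒ (A ∧ B))))
  ax6 : ∀ A B → Axiom (A ⇒ (A ∨ B))
  ax7 : ∀ A B → Axiom (B ⇒ (A ∨ B))
  ax8 : ∀ A B C → Axiom ((A ⇒ C) ⇒ ((B ⇒ C) ⇒ ((A ∨ B) ⇒ C)))
  axM1 : ∀ A B → Axiom ((A ⇒ B) ⊃ (A ⊃ B))
  axM2 : ∀ A B C → Axiom ((A ⊃ (B ⊃ C)) ⇒ ((A ⊃ B) ⊃ (A ⊃ C)))
  axM3 : ∀ A B C → Axiom ((A ⊃ (B ⇒ C)) ⇒ (B ⇒ (A ⊃ C)))
  axM4 : ∀ A B C → Axiom ((A ⇒ (B ⊃ C)) ⇒ (B ⊃ (A ⇒ C)))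
  axM5 : ∀ A B C → Axiom (((A ⊃ B) ⊃ C) ⇒ ((A ⊃ C) ⇒ C))
  axM6 : ∀ A B C → Axiom ((A ⊃ C) ⇒ ((B ⊃ C) ⇒ ((A ∨ B) ⊃ C)))

infix 3 _⊢_
data _⊢_ (Γ : FormSet) : Form → Set where
  hyp : ∀ {A} → Γ A → Γ ⊢ A
  ax  : ∀ {A} → Axiom A → Γ ⊢ A
  mp  : ∀ {A B} → Γ ⊢ A → Γ ⊢ (A ⊃ B) → Γ ⊢ B

infix 2 _⇔_
_⇔_ : Set → Set → Set
P ⇔ Q = (P → Q) × (Q → P)

-- S-models.  The extension I of V is included as a field together with the
-- defining clauses; classically these clauses determine I uniquely from V.
record SModel : Set₁ where
  field
    W     : Set
    g     : W
    _≤_   : W → W → Set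
    refl≤ : ∀ w → w ≤ w
    trans≤ : ∀ {u v w} → u ≤ v → v ≤ w → u ≤ w
    root  : ∀ w → g ≤ w
    V     : W → Var → Bool
    mono  : ∀ {w₁ w₂} p → V w₁ p ≡ true → w₁ ≤ w₂ → V w₂ p ≡ true
    I     : W → Form → Bool
    I-var : ∀ w p → I w (var p) ≡ V w p
    I-∧   : ∀ w A B → (I w (A ∧ B) ≡ true) ⇔ ((I w A ≡ true) × (I w B ≡ true))
    I-∨   : ∀ w A B → (I w (A ∨ B) ≡ true) ⇔ ((I w A ≡ true) ⊎ (I w B ≡ true))
    I-⊃   : ∀ w A B → (I w (A ⊃ B) ≡ true) ⇔ ((¬ (I g A ≡ true)) ⊎ (I w B ≡ true))
    I-⇒   : ∀ w A B → (I w (A ⇒ B) ≡ true) ⇔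
              (∀ x → w ≤ x → I x A ≡ true → I x B ≡ true)

infix 3 _⊨_
_⊨_ : FormSet → Form → Set₁
Σ ⊨ A = (M : SModel) → (∀ B → Σ B → SModel.I M (SModel.g M) B ≡ true)
          → SModel.I M (SModel.g M) A ≡ true

-- Truth in an S-model is upward persistent, and a classical implication
-- A ⊃ B consults A only at the root g; since g lies below every world, each
-- axiom is true at g, and (MP) preserves truth at g.
module Submission where

open import Defs
open import Data.Bool using (true)
open import Data.Bool.Properties using (_≟_)
open import Data.Product using (_,_; proj₁; proj₂)
open import Data.Sum using (inj₁; inj₂; [_,_])
open import Relation.Nullary using (¬_; yes; no; Dec; contradiction)
open import Function using (case_of_)
open import Relation.Binary.PropositionalEquality using (_≡_; trans; sym)

module Forcing (M : SModel) where
  open SModel M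

  infix 3 _⊩_
  _⊩_ : W → Form → Set
  w ⊩ A = I w A ≡ true

  _⊩?_ : ∀ w A → Dec (w ⊩ A)
  w ⊩? A = I w A ≟ true

  ⊩⇒-intro : ∀ {w A B} → (∀ x → w ≤ x → x ⊩ A → x ⊩ B) → w ⊩ A ⇒ B
  ⊩⇒-intro {w} {A} {B} = proj₂ (I-⇒ w A B)

  ⊩⇒-elim : ∀ {w x A B} → w ⊩ A ⇒ B → w ≤ x → x ⊩ A → x ⊩ B
  ⊩⇒-elim {w} {x} {A} {B} h = proj₁ (I-⇒ w A B) h x

  ⊩⊃-vacuous : ∀ {w A B} → ¬ (g ⊩ A) → w ⊩ A ⊃ B
  ⊩⊃-vacuous {w} {A} {B} ¬a = proj₂ (I-⊃ w A B) (inj₁ ¬a)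

  ⊩⊃-intro : ∀ {w A B} → (g ⊩ A → w ⊩ B) → w ⊩ A ⊃ B
  ⊩⊃-intro {w} {A} {B} f with g ⊩? A
  ... | yes a = proj₂ (I-⊃ w A B) (inj₂ (f a))
  ... | no ¬a = ⊩⊃-vacuous ¬a

  ⊩⊃-elim : ∀ {w A B} → w ⊩ A ⊃ B → g ⊩ A → w ⊩ B
  ⊩⊃-elim {w} {A} {B} h a with proj₁ (I-⊃ w A B) h
  ... | inj₁ ¬a = contradiction a ¬a
  ... | inj₂ b  = b

  ⊩∧-intro : ∀ {w A B} → w ⊩ A → w ⊩ B → w ⊩ A ∧ B
  ⊩∧-intro {w} {A} {B} a b = proj₂ (I-∧ w A B) (a , b)

  ⊩∧-proj₁ : ∀ {w A B} → w ⊩ A ∧ B → w ⊩ A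
  ⊩∧-proj₁ {w} {A} {B} h = proj₁ (proj₁ (I-∧ w A B) h)

  ⊩∧-proj₂ : ∀ {w A B} → w ⊩ A ∧ B → w ⊩ B
  ⊩∧-proj₂ {w} {A} {B} h = proj₂ (proj₁ (I-∧ w A B) h)

  ⊩∨-inj₁ : ∀ {w A B} → w ⊩ A → w ⊩ A ∨ B
  ⊩∨-inj₁ {w} {A} {B} a = proj₂ (I-∨ w A B) (inj₁ a)

  ⊩∨-inj₂ : ∀ {w A B} → w ⊩ B → w ⊩ A ∨ B
  ⊩∨-inj₂ {w} {A} {B} b = proj₂ (I-∨ w A B) (inj₂ b)

  ⊩∨-elim : ∀ {w A B} {P : Set} → (w ⊩ A → P) → (w ⊩ B → P) → w ⊩ A ∨ B → P
  ⊩∨-elim {w} {A} {B} f h d = [ f , h ] (proj₁ (I-∨ w A B) d)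

  ⊩-mono : ∀ A {u v} → u ⊩ A → u ≤ v → v ⊩ A
  ⊩-mono (var p) {u} {v} h u≤v =
    trans (I-var v p) (mono p (trans (sym (I-var u p)) h) u≤v)
  ⊩-mono (A ∧ B) h u≤v =
    ⊩∧-intro (⊩-mono A (⊩∧-proj₁ h) u≤v) (⊩-mono B (⊩∧-proj₂ h) u≤v)
  ⊩-mono (A ∨ B) h u≤v =
    ⊩∨-elim (λ a → ⊩∨-inj₁ (⊩-mono A a u≤v))
            (λ b → ⊩∨-inj₂ (⊩-mono B b u≤v)) h
  ⊩-mono (A ⇒ B) h u≤v = ⊩⇒-intro λ x v≤x → ⊩⇒-elim h (trans≤ u≤v v≤x)
  ⊩-mono (A ⊃ B) h u≤v = ⊩⊃-intro λ a → ⊩-mono B (⊩⊃-elim h a) u≤v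

  ⊩-axiom : ∀ {A} → Axiom A → g ⊩ A
  ⊩-axiom (ax1 A B) = ⊩⇒-intro λ x _ a → ⊩⇒-intro λ y x≤y _ → ⊩-mono A a x≤y
  ⊩-axiom (ax2 A B C) = ⊩⇒-intro λ x _ f → ⊩⇒-intro λ y x≤y h → ⊩⇒-intro λ z y≤z a →
    ⊩⇒-elim (⊩⇒-elim f (trans≤ x≤y y≤z) a) (refl≤ z) (⊩⇒-elim h y≤z a)
  ⊩-axiom (ax3 A B) = ⊩⇒-intro λ _ _ → ⊩∧-proj₁
  ⊩-axiom (ax4 A B) = ⊩⇒-intro λ _ _ → ⊩∧-proj₂
  ⊩-axiom (ax5 A B C) = ⊩⇒-intro λ x _ f → ⊩⇒-intro λ y x≤y h → ⊩⇒-intro λ z y≤z c →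
    ⊩∧-intro (⊩⇒-elim f (trans≤ x≤y y≤z) c) (⊩⇒-elim h y≤z c)
  ⊩-axiom (ax6 A B) = ⊩⇒-intro λ _ _ → ⊩∨-inj₁
  ⊩-axiom (ax7 A B) = ⊩⇒-intro λ _ _ → ⊩∨-inj₂
  ⊩-axiom (ax8 A B C) = ⊩⇒-intro λ x _ f → ⊩⇒-intro λ y x≤y h → ⊩⇒-intro λ z y≤z →
    ⊩∨-elim (⊩⇒-elim f (trans≤ x≤y y≤z)) (⊩⇒-elim h y≤z)
  ⊩-axiom (axM1 A B) = ⊩⊃-intro λ h → ⊩⊃-intro (⊩⇒-elim h (refl≤ g))
  ⊩-axiom (axM2 A B C) = ⊩⇒-intro λ _ _ f → ⊩⊃-intro λ ab → ⊩⊃-intro λ a →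
    ⊩⊃-elim (⊩⊃-elim f a) (⊩⊃-elim ab a)
  ⊩-axiom (axM3 A B C) = ⊩⇒-intro λ _ _ f → ⊩⇒-intro λ y x≤y b → ⊩⊃-intro λ a →
    ⊩⇒-elim (⊩⊃-elim f a) x≤y b
  ⊩-axiom (axM4 A B C) = ⊩⇒-intro λ _ _ f → ⊩⊃-intro λ b → ⊩⇒-intro λ z x≤z a →
    ⊩⊃-elim (⊩⇒-elim f x≤z a) b
  ⊩-axiom (axM5 A B C) = ⊩⇒-intro λ _ _ f → ⊩⇒-intro λ y x≤y h → case g ⊩? A of λ where
    (yes a) → ⊩⊃-elim h a
    (no ¬a) → ⊩-mono C (⊩⊃-elim f (⊩⊃-vacuous ¬a)) x≤y
  ⊩-axiom (axM6 A B C) = ⊩⇒-intro λ _ _ f → ⊩⇒-intro λ y x≤y h → ⊩⊃-intro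
    (⊩∨-elim (λ a → ⊩-mono C (⊩⊃-elim f a) x≤y) (⊩⊃-elim h))

  ⊩-derivable : ∀ {Γ A} → Γ ⊢ A → (∀ B → Γ B → g ⊩ B) → g ⊩ A
  ⊩-derivable (hyp {A} γ) ⊩Γ = ⊩Γ A γ
  ⊩-derivable (ax a)      _  = ⊩-axiom a
  ⊩-derivable (mp d e)    ⊩Γ =
    ⊩⊃-elim (⊩-derivable e ⊩Γ) (⊩-derivable d ⊩Γ)

mainTheorem1 : (Γ : FormSet) (A : Form) → Γ ⊢ A → Γ ⊨ A
mainTheorem1 Γ A d M = Forcing.⊩-derivable M d
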